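{- Let $n>1$. Every word over an alphabet of $n$ symbols with no two consecutive equal symbols and of length greater than $2\cdot n!-1$ has a subword in which exactly $k$ distinct symbols occur, for some $1<k\le n$, and each of these $k$ symbols occurs at least $k$ times in the subword. Furthermore, this bound is tight: there exists a word $w$ of length $2\cdot n!-1$ over $n$ symbols, with no two consecutive equal symbols, such that for every $1<k\le n$, $w$ has no subword in which exactly $k$ distinct symbols occur each at least $k$ times.
   Context: A subword of a word means a contiguous block of consecutive symbols of the word. -}

module Defs where

open import Data.Nat using (ℕ; _≤_; _<_; _*_)
open import Data.Nat using (_!)
open import Data.Fin using (Fin)
open import Data.Fin.Properties using (_≟_)
open import Data.List using (List; _++_; length; filter; allFin)
open import Data.List.Membership.Propositional using (_∈_)
open import Data.List.Relation.Unary.Any using (any?)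
open import Data.List.Relation.Unary.Linked using (Linked)
open import Data.Product using (Σ; _×_; ∃-syntax)
open import Relation.Binary.PropositionalEquality using (_≡_; _≢_)

Word : ℕ → Set
Word n = List (Fin n)

NoConsecutiveEqual : ∀ {n} → Word n → Set
NoConsecutiveEqual = Linked _≢_

IsSubword : ∀ {n} → Word n → Word n → Set
IsSubword {n} s w = ∃[ u ] ∃[ v ] (w ≡ u ++ s ++ v)

occ : ∀ {n} → Fin n → Word n → ℕ
occ a s = length (filter (a ≟_) s)

distinctCount : ∀ {n} → Word n → ℕ
distinctCount {n} s = length (filter (λ a → any? (a ≟_) s) (allFin n))

KGood : ∀ {n} → ℕ → Word n → Set
KGood {n} k s = distinctCount s ≡ k × (∀ (a : Fin n) → a ∈ s → k ≤ occ a s)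

HasGoodSubword : ∀ {n} → Word n → Set
HasGoodSubword {n} w =
  ∃[ k ] (1 < k × k ≤ n × ∃[ s ] (IsSubword s w × KGood k s))

-- Upper bound: by induction on d, a word on at most d distinct symbols with no two equal
-- neighbours either has a good subword or has length at most 2·d! − 1. If such a word w
-- with k distinct symbols is not itself k-good, some symbol a occurs fewer than k ≤ d
-- times; cutting w at the occurrences of a leaves at most d pieces, each on at most d − 1
-- symbols, so |w| + 1 ≤ d · 2·(d − 1)! = 2·d!.
--
-- Tightness: V₀ is the one-letter word 0 and V_{j+1} = V_j c V_j c … c V_j, with j + 2
-- copies of V_j separated by the new symbol c = j + 1, so |V_j| + 1 = 2·(j + 1)!. In a
-- subword s of V_{j+1} on at least two symbols, some symbol occurs fewer times than s has
-- distinct symbols: if c does not occur, s lies in a copy of V_j; if c occurs once, c is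
-- such a symbol; if c occurs twice, s contains a whole copy of V_j, hence at least j + 2
-- distinct symbols, while c occurs at most j + 1 times.

module Submission where

open import Defs
open import Data.Fin as Fin using (Fin; toℕ)
open import Data.Fin.Properties using (_≟_)
open import Data.List using ([]; _∷_; [_]; _++_; length; filter; allFin)
open import Data.List.Properties
  using (length-++; ++-assoc; ++-identityʳ; ∷-injective; ++-conicalʳ; length-tabulate
        ; length-filter; filter-some; filter-none; filter-++; filter-accept)
open import Data.List.Membership.Propositional using (_∈_; _∉_; find; lose)
open import Data.List.Membership.Propositional.Properties using (∈-allFin; ∈-++⁺ˡ; ∈-++⁺ʳ; ∈-++⁻)
open import Data.List.Relation.Binary.Subset.Propositional using (_⊆_)
import Data.List.Relation.Binary.Sublist.Propositional as Sublist
import Data.List.Relation.Binary.Sublist.Propositional.Properties as Sublist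
open import Data.List.Relation.Unary.All using (all?; universal) renaming (lookup to lookupAll)
open import Data.List.Relation.Unary.All.Properties using (¬All⇒Any¬; ¬Any⇒All¬)
open import Data.List.Relation.Unary.Any using (here; there; any?)
open import Data.List.Relation.Unary.Linked using (Linked; []; [-]; _∷_; tail)
open import Data.Nat using (ℕ; zero; suc; _+_; _*_; _∸_; _≤_; _<_; z≤n; s≤s; _!)
open import Data.Nat.Properties
  using (_≤?_; ≤-refl; ≤-reflexive; ≤-trans; ≤-pred; <⇒≤; <⇒≱; ≰⇒>; 1+n≰n; m≤n⇒m≤1+n
        ; m<n⇒m<1+n; m≤m+n; m≤n+m; m≤n+m∸n; +-identityʳ; +-assoc; +-mono-≤; *-comm; *-assoc
        ; *-monoˡ-≤; *-monoʳ-≤; 1≤n!; module ≤-Reasoning)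
open import Data.Product using (_×_; _,_; proj₁; proj₂; ∃-syntax; Σ-syntax)
open import Function using (_∘_; case_of_)
open import Data.Sum using (_⊎_; inj₁; inj₂; map₁; map₂)
open import Relation.Binary.Core using (Rel)
open import Relation.Binary.PropositionalEquality
  using (_≡_; _≢_; refl; sym; trans; cong; cong₂; subst; subst₂; module ≡-Reasoning)
open import Relation.Nullary using (¬_; yes; no; contradiction)
open import Relation.Unary using (Pred; Decidable)

module _ {a p q} {A : Set a} {P : Pred A p} {Q : Pred A q}
         (P? : Decidable P) (Q? : Decidable Q) (P⇒Q : ∀ {x} → P x → Q x) where

  length-filter-mono : ∀ xs → length (filter P? xs) ≤ length (filter Q? xs)
  length-filter-mono xs =
    Sublist.length-mono-≤ (Sublist.filter⁺ P? Q? (λ { refl → P⇒Q }) (Sublist.⊆-refl {x = xs}))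

  length-filter-strict : ∀ {x} xs → x ∈ xs → Q x → ¬ P x →
                         length (filter P? xs) < length (filter Q? xs)
  length-filter-strict (y ∷ xs) (here refl) Qx ¬Px with P? y | Q? y
  ... | yes Py | _      = contradiction Py ¬Px
  ... | no _   | yes _  = s≤s (length-filter-mono xs)
  ... | no _   | no ¬Qy = contradiction Qx ¬Qy
  length-filter-strict (y ∷ xs) (there x∈xs) Qx ¬Px
    with P? y | Q? y | length-filter-strict xs x∈xs Qx ¬Px
  ... | yes _  | yes _  | ih = s≤s ih
  ... | yes Py | no ¬Qy | _  = contradiction (P⇒Q Py) ¬Qy
  ... | no _   | yes _  | ih = m<n⇒m<1+n ih
  ... | no _   | no _   | ih = ih

module _ {a r} {A : Set a} {R : Rel A r} where

  Linked-++⁻ˡ : ∀ xs {ys} → Linked R (xs ++ ys) → Linked R xs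
  Linked-++⁻ˡ []           _         = []
  Linked-++⁻ˡ (x ∷ [])     _         = [-]
  Linked-++⁻ˡ (x ∷ y ∷ xs) (Rxy ∷ l) = Rxy ∷ Linked-++⁻ˡ (y ∷ xs) l

  Linked-++⁻ʳ : ∀ xs {ys} → Linked R (xs ++ ys) → Linked R ys
  Linked-++⁻ʳ []       l = l
  Linked-++⁻ʳ (x ∷ xs) l = Linked-++⁻ʳ xs (tail l)

  Linked-++-∷⁺ : ∀ {xs y ys} → Linked R xs → Linked R (y ∷ ys) →
                 (∀ {x} → x ∈ xs → R x y) → Linked R (xs ++ y ∷ ys)
  Linked-++-∷⁺ []          l R∙y = l
  Linked-++-∷⁺ [-]         l R∙y = R∙y (here refl) ∷ l
  Linked-++-∷⁺ (Rxz ∷ lxs) l R∙y = Rxz ∷ Linked-++-∷⁺ lxs l (λ x∈ → R∙y (there x∈))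

module _ {a} {A : Set a} {c : A} where

  ∉-prefix : ∀ {s} X {Y v} → c ∉ s → X ++ c ∷ Y ≡ s ++ v → ∃[ v′ ] X ≡ s ++ v′
  ∉-prefix {[]}    X        _   _  = X , refl
  ∉-prefix {x ∷ s} []       c∉s eq = contradiction (here (proj₁ (∷-injective eq))) c∉s
  ∉-prefix {x ∷ s} (_ ∷ X)  c∉s eq with ∷-injective eq
  ... | refl , eq′ with ∉-prefix X (c∉s ∘ there) eq′
  ...   | v′ , refl = v′ , refl

  ∉-++-∷-split : ∀ {X Y} U {Z} → c ∉ X → X ++ c ∷ Y ≡ U ++ c ∷ Z →
                 (X ≡ U × Y ≡ Z) ⊎ ∃[ U′ ] (U ≡ X ++ c ∷ U′ × Y ≡ U′ ++ c ∷ Z)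
  ∉-++-∷-split {[]}    []       _   eq = inj₁ (refl , proj₂ (∷-injective eq))
  ∉-++-∷-split {[]}    (_ ∷ U′) _   eq with ∷-injective eq
  ... | refl , Y≡ = inj₂ (U′ , refl , Y≡)
  ∉-++-∷-split {x ∷ X} []       c∉X eq = contradiction (here (sym (proj₁ (∷-injective eq)))) c∉X
  ∉-++-∷-split {x ∷ X} (_ ∷ U)  c∉X eq with ∷-injective eq
  ... | refl , eq′ with ∉-++-∷-split U (c∉X ∘ there) eq′
  ...   | inj₁ (refl , Y≡Z)       = inj₁ (refl , Y≡Z)
  ...   | inj₂ (U′ , refl , Y≡)   = inj₂ (U′ , refl , Y≡)

  ∉-++-∷-cancelˡ : ∀ {X Y U Z} → c ∉ X → c ∉ U → X ++ c ∷ Y ≡ U ++ c ∷ Z → X ≡ U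
  ∉-++-∷-cancelˡ {X} {U = U} c∉X c∉U eq with ∉-++-∷-split U c∉X eq
  ... | inj₁ (X≡U , _)       = X≡U
  ... | inj₂ (U′ , refl , _) = contradiction (∈-++⁺ʳ X (here refl)) c∉U

module _ {n : ℕ} where

  occ-++ : (a : Fin n) (xs ys : Word n) → occ a (xs ++ ys) ≡ occ a xs + occ a ys
  occ-++ a xs ys = trans (cong length (filter-++ (a ≟_) xs ys)) (length-++ (filter (a ≟_) xs))

  occ-∉ : ∀ {a} {s : Word n} → a ∉ s → occ a s ≡ 0
  occ-∉ {a} {s} a∉s = cong length (filter-none (a ≟_) (¬Any⇒All¬ s a∉s))

  occ-∷ : ∀ {a} (s : Word n) → occ a (a ∷ s) ≡ suc (occ a s)
  occ-∷ {a} s = cong length (filter-accept (a ≟_) {xs = s} refl)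

  occ-once : ∀ {a} (s₁ s₂ : Word n) → a ∉ s₁ → a ∉ s₂ → occ a (s₁ ++ a ∷ s₂) ≡ 1
  occ-once {a} s₁ s₂ a∉s₁ a∉s₂ = begin
    occ a (s₁ ++ a ∷ s₂)        ≡⟨ occ-++ a s₁ (a ∷ s₂) ⟩
    occ a s₁ + occ a (a ∷ s₂)   ≡⟨ cong₂ _+_ (occ-∉ a∉s₁) (occ-∷ s₂) ⟩
    suc (occ a s₂)              ≡⟨ cong suc (occ-∉ a∉s₂) ⟩
    1                           ∎
    where open ≡-Reasoning

  ∈-split : ∀ {a} {s : Word n} → a ∈ s → ∃[ s₁ ] ∃[ s₂ ] (s ≡ s₁ ++ a ∷ s₂ × a ∉ s₁)
  ∈-split {a} {x ∷ s} a∈ with a ≟ x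
  ... | yes refl = [] , s , refl , λ ()
  ... | no a≢x with a∈
  ...   | here a≡x = contradiction a≡x a≢x
  ...   | there a∈s with ∈-split a∈s
  ...     | s₁ , s₂ , refl , a∉s₁ =
    x ∷ s₁ , s₂ , refl , λ { (here a≡x) → a≢x a≡x ; (there a∈s₁) → a∉s₁ a∈s₁ }

  distinctCount-strict : ∀ {s w : Word n} {a} → s ⊆ w → a ∈ w → a ∉ s →
                         distinctCount s < distinctCount w
  distinctCount-strict {s} {w} {a} s⊆w =
    length-filter-strict (λ a → any? (a ≟_) s) (λ a → any? (a ≟_) w) s⊆w (allFin n) (∈-allFin a)

  distinctCount≤n : (s : Word n) → distinctCount s ≤ n
  distinctCount≤n s =
    ≤-trans (length-filter (λ a → any? (a ≟_) s) (allFin n)) (≤-reflexive (length-tabulate {n = n} (λ i → i)))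

  distinctCount-[] : distinctCount {n} [] ≡ 0
  distinctCount-[] = cong length (filter-none (λ a → any? (a ≟_) []) (universal (λ _ ()) (allFin n)))

  distinctCount-∈ : ∀ {a} {s : Word n} → a ∈ s → 0 < distinctCount s
  distinctCount-∈ {a} {s} a∈s = filter-some (λ a → any? (a ≟_) s) (lose (∈-allFin a) a∈s)

  2≤distinctCount : ∀ {x y} {r : Word n} → x ≢ y → 2 ≤ distinctCount (x ∷ y ∷ r)
  2≤distinctCount {x} x≢y = ≤-trans (s≤s (distinctCount-∈ {s = [ x ]} (here refl)))
    (distinctCount-strict (λ { (here refl) → here refl }) (there (here refl))
                          (λ { (here y≡x) → x≢y (sym y≡x) }))

  IsSubword-refl : (w : Word n) → IsSubword w w
  IsSubword-refl w = [] , [] , sym (++-identityʳ w)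

  IsSubword-trans : {s t w : Word n} → IsSubword s t → IsSubword t w → IsSubword s w
  IsSubword-trans {s} (u′ , v′ , refl) (u , v , refl) = u ++ u′ , v′ ++ v , (begin
    u ++ (u′ ++ s ++ v′) ++ v   ≡⟨ cong (u ++_) (++-assoc u′ (s ++ v′) v) ⟩
    u ++ u′ ++ (s ++ v′) ++ v   ≡⟨ cong (λ t → u ++ u′ ++ t) (++-assoc s v′ v) ⟩
    u ++ u′ ++ s ++ v′ ++ v     ≡⟨ ++-assoc u u′ (s ++ v′ ++ v) ⟨
    (u ++ u′) ++ s ++ v′ ++ v   ∎)
    where open ≡-Reasoning

  IsSubword-suffix : (u w : Word n) → IsSubword w (u ++ w)
  IsSubword-suffix u w = u , [] , cong (u ++_) (sym (++-identityʳ w))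

  IsSubword⇒⊆ : {s w : Word n} → IsSubword s w → s ⊆ w
  IsSubword⇒⊆ (u , v , refl) b∈s = ∈-++⁺ʳ u (∈-++⁺ˡ b∈s)

  occ-mono : (a : Fin n) {s w : Word n} → IsSubword s w → occ a s ≤ occ a w
  occ-mono a {s} (u , v , refl) = begin
    occ a s                       ≤⟨ m≤m+n (occ a s) (occ a v) ⟩
    occ a s + occ a v             ≡⟨ occ-++ a s v ⟨
    occ a (s ++ v)                ≤⟨ m≤n+m (occ a (s ++ v)) (occ a u) ⟩
    occ a u + occ a (s ++ v)      ≡⟨ occ-++ a u (s ++ v) ⟨
    occ a (u ++ s ++ v)           ∎
    where open ≤-Reasoning

  NoConsecutiveEqual-subword : {s w : Word n} → IsSubword s w →
                               NoConsecutiveEqual w → NoConsecutiveEqual s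
  NoConsecutiveEqual-subword {s} (u , v , refl) ncw = Linked-++⁻ˡ s (Linked-++⁻ʳ u ncw)

HasRareSymbol : ∀ {n} → Word n → Set
HasRareSymbol s = ∃[ a ] (a ∈ s × occ a s < distinctCount s)

module _ {n : ℕ} where

  KGood-or-HasRareSymbol : (w : Word n) → KGood (distinctCount w) w ⊎ HasRareSymbol w
  KGood-or-HasRareSymbol w with all? (λ a → distinctCount w ≤? occ a w) w
  ... | yes frequent = inj₁ (refl , λ a a∈w → lookupAll frequent a∈w)
  ... | no ¬frequent with find (¬All⇒Any¬ (λ a → distinctCount w ≤? occ a w) w ¬frequent)
  ...   | a , a∈w , ¬dc≤occ = inj₂ (a , a∈w , ≰⇒> ¬dc≤occ)

  HasRareSymbol⇒¬KGood : ∀ {k} {s : Word n} → HasRareSymbol s → ¬ KGood k s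
  HasRareSymbol⇒¬KGood (a , a∈s , rare) (refl , frequent) = <⇒≱ rare (frequent a a∈s)

  HasGoodSubword-mono : {s w : Word n} → IsSubword s w → HasGoodSubword s → HasGoodSubword w
  HasGoodSubword-mono s⊑w (k , 1<k , k≤n , t , t⊑s , good) =
    k , 1<k , k≤n , t , IsSubword-trans t⊑s s⊑w , good

module _ {n : ℕ} (a : Fin n) {G : Set} {K : ℕ} where

  -- Cutting w at the occurrences of a leaves suc (occ a w) a-free pieces.
  length-cut : (w : Word n) → (∀ s → IsSubword s w → a ∉ s → G ⊎ suc (length s) ≤ K) →
               G ⊎ suc (length w) ≤ suc (occ a w) * K
  length-cut w = cut [] w (λ ())
    where
    -- p is the part of the current piece that has already been read.
    cut : ∀ p w → a ∉ p → (∀ s → IsSubword s (p ++ w) → a ∉ s → G ⊎ suc (length s) ≤ K) →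
          G ⊎ suc (length p + length w) ≤ suc (occ a w) * K
    cut p [] a∉p short =
      map₂ (subst₂ (λ l k → suc l ≤ k) (sym (+-identityʳ _)) (sym (+-identityʳ K)))
           (short p ([] , [] , refl) a∉p)
    cut p (x ∷ w) a∉p short with a ≟ x
    ... | no a≢x =
      map₂ (subst (λ l → suc l ≤ suc (occ a w) * K) length-px)
           (cut (p ++ [ x ]) w a∉px (subst (λ t → ∀ s → IsSubword s t → _) (sym (++-assoc p [ x ] w)) short))
      where
      a∉px : a ∉ p ++ [ x ]
      a∉px a∈px with ∈-++⁻ p a∈px
      ... | inj₁ a∈p        = a∉p a∈p
      ... | inj₂ (here a≡x) = a≢x a≡x
      length-px : length (p ++ [ x ]) + length w ≡ length p + suc (length w)
      length-px = trans (cong (_+ length w) (length-++ p)) (+-assoc (length p) 1 (length w))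
    ... | yes refl with short p ([] , a ∷ w , refl) a∉p
    ...   | inj₁ g       = inj₁ g
    ...   | inj₂ p-short = map₂ (+-mono-≤ p-short) (cut [] w (λ ()) short-w)
      where
      w⊑paw : IsSubword w (p ++ a ∷ w)
      w⊑paw = subst (IsSubword w) (++-assoc p [ a ] w) (IsSubword-suffix (p ++ [ a ]) w)
      short-w : ∀ s → IsSubword s w → a ∉ s → G ⊎ suc (length s) ≤ K
      short-w s s⊑w = short s (IsSubword-trans s⊑w w⊑paw)

2≤2*n! : ∀ d → 2 ≤ 2 * d !
2≤2*n! d = *-monoʳ-≤ 2 (1≤n! d)

suc-*-2*n! : ∀ d → suc d * (2 * d !) ≡ 2 * suc d !
suc-*-2*n! d = begin
  suc d * (2 * d !)   ≡⟨ *-assoc (suc d) 2 (d !) ⟨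
  suc d * 2 * d !     ≡⟨ cong (_* d !) (*-comm (suc d) 2) ⟩
  2 * suc d * d !     ≡⟨ *-assoc 2 (suc d) (d !) ⟩
  2 * suc d !         ∎
  where open ≡-Reasoning

module _ {n : ℕ} where

  HasGoodSubword-or-short : ∀ d (w : Word n) → NoConsecutiveEqual w → distinctCount w ≤ d →
                            HasGoodSubword w ⊎ suc (length w) ≤ 2 * d !
  HasGoodSubword-or-short d []       _ _ = inj₂ (≤-trans (s≤s z≤n) (2≤2*n! d))
  HasGoodSubword-or-short d (x ∷ []) _ _ = inj₂ (2≤2*n! d)
  HasGoodSubword-or-short zero (x ∷ y ∷ r) (x≢y ∷ _) dc≤0 =
    contradiction (≤-trans (2≤distinctCount x≢y) dc≤0) λ ()
  HasGoodSubword-or-short (suc d) w@(x ∷ y ∷ r) ncw@(x≢y ∷ _) dc≤1+d with KGood-or-HasRareSymbol w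
  ... | inj₁ good =
    inj₁ (distinctCount w , 2≤distinctCount x≢y , distinctCount≤n w , w , IsSubword-refl w , good)
  ... | inj₂ (a , a∈w , rare) = map₂ (λ short → ≤-trans short pieces≤) (length-cut a w short-piece)
    where
    short-piece : ∀ s → IsSubword s w → a ∉ s → HasGoodSubword w ⊎ suc (length s) ≤ 2 * d !
    short-piece s s⊑w a∉s = map₁ (HasGoodSubword-mono s⊑w)
      (HasGoodSubword-or-short d s (NoConsecutiveEqual-subword s⊑w ncw)
        (≤-pred (≤-trans (distinctCount-strict (IsSubword⇒⊆ s⊑w) a∈w a∉s) dc≤1+d)))
    pieces≤ : suc (occ a w) * (2 * d !) ≤ 2 * suc d !
    pieces≤ = ≤-trans (*-monoˡ-≤ (2 * d !) (≤-trans rare dc≤1+d)) (≤-reflexive (suc-*-2*n! d))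

  long⇒HasGoodSubword : (w : Word n) → NoConsecutiveEqual w → 2 * n ! ∸ 1 < length w →
                        HasGoodSubword w
  long⇒HasGoodSubword w ncw long with HasGoodSubword-or-short n w ncw (distinctCount≤n w)
  ... | inj₁ good  = good
  ... | inj₂ short = contradiction (≤-trans short (≤-trans (m≤n+m∸n (2 * n !) 1) long)) 1+n≰n

module _ {n : ℕ} (c : Fin n) where

  copies : Word n → ℕ → Word n
  copies B zero    = B
  copies B (suc r) = B ++ c ∷ copies B r

  length-copies : ∀ B r → suc (length (copies B r)) ≡ suc r * suc (length B)
  length-copies B zero    = sym (+-identityʳ _)
  length-copies B (suc r) = trans (cong suc (length-++ B)) (cong (suc (length B) +_) (length-copies B r))

  ∈-copies⁻ : ∀ {x} B r → x ∈ copies B r → x ∈ B ⊎ x ≡ c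
  ∈-copies⁻ B zero    x∈ = inj₁ x∈
  ∈-copies⁻ B (suc r) x∈ with ∈-++⁻ B x∈
  ... | inj₁ x∈B        = inj₁ x∈B
  ... | inj₂ (here x≡c) = inj₂ x≡c
  ... | inj₂ (there x∈) = ∈-copies⁻ B r x∈

  IsSubword-∉-++-∷ : ∀ {s} X {Y} → c ∉ s → IsSubword s (X ++ c ∷ Y) → IsSubword s X ⊎ IsSubword s Y
  IsSubword-∉-++-∷ X       c∉s ([]    , v , eq) = inj₁ ([] , ∉-prefix X c∉s eq)
  IsSubword-∉-++-∷ []      c∉s (_ ∷ u , v , eq) = inj₂ (u , v , proj₂ (∷-injective eq))
  IsSubword-∉-++-∷ (x ∷ X) c∉s (_ ∷ u , v , eq) with ∷-injective eq
  ... | refl , eq′ = map₁ (λ s⊑X → IsSubword-trans s⊑X (IsSubword-suffix [ x ] X))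
                          (IsSubword-∉-++-∷ X c∉s (u , v , eq′))

  ∉-IsSubword-copies : ∀ {s} B r → c ∉ s → IsSubword s (copies B r) → IsSubword s B
  ∉-IsSubword-copies B zero    c∉s s⊑ = s⊑
  ∉-IsSubword-copies B (suc r) c∉s s⊑ with IsSubword-∉-++-∷ B c∉s s⊑
  ... | inj₁ s⊑B = s⊑B
  ... | inj₂ s⊑  = ∉-IsSubword-copies B r c∉s s⊑

  copies-linked : ∀ {B} → B ≢ [] → c ∉ B → NoConsecutiveEqual B → ∀ r → NoConsecutiveEqual (copies B r)
  copies-linked {[]}    B≢[] _   _   _ = contradiction refl B≢[]
  copies-linked {b ∷ B} _    c∉B ncB   = linked
    where
    linked : ∀ r → NoConsecutiveEqual (copies (b ∷ B) r)
    c∷linked : ∀ r → NoConsecutiveEqual (c ∷ copies (b ∷ B) r)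
    linked zero    = ncB
    linked (suc r) = Linked-++-∷⁺ ncB (c∷linked r) (λ x∈B x≡c → c∉B (subst (_∈ b ∷ B) x≡c x∈B))
    c∷linked zero    = c∉B ∘ here ∷ ncB
    c∷linked (suc r) = c∉B ∘ here ∷ linked (suc r)

  module _ {B : Word n} (c∉B : c ∉ B) where

    occ-copies : ∀ r → occ c (copies B r) ≡ r
    occ-copies zero    = occ-∉ c∉B
    occ-copies (suc r) = begin
      occ c (B ++ c ∷ copies B r)         ≡⟨ occ-++ c B (c ∷ copies B r) ⟩
      occ c B + occ c (c ∷ copies B r)    ≡⟨ cong₂ _+_ (occ-∉ c∉B) (occ-∷ (copies B r)) ⟩
      suc (occ c (copies B r))            ≡⟨ cong suc (occ-copies r) ⟩
      suc r                               ∎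
      where open ≡-Reasoning

    copies-first-block : ∀ {t Z} r → c ∉ t → copies B r ≡ t ++ c ∷ Z → t ≡ B
    copies-first-block {t} zero    c∉t eq = contradiction (subst (c ∈_) (sym eq) (∈-++⁺ʳ t (here refl))) c∉B
    copies-first-block     (suc r) c∉t eq = sym (∉-++-∷-cancelˡ c∉B c∉t eq)

    copies-block : ∀ {t Z} r U → c ∉ t → copies B r ≡ U ++ c ∷ t ++ c ∷ Z → t ≡ B
    copies-block zero    U c∉t eq = contradiction (subst (c ∈_) (sym eq) (∈-++⁺ʳ U (here refl))) c∉B
    copies-block (suc r) U c∉t eq with ∉-++-∷-split U c∉B eq
    ... | inj₁ (_ , eq′)      = copies-first-block r c∉t eq′
    ... | inj₂ (U′ , _ , eq′) = copies-block r U′ c∉t eq′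

    separated-block : ∀ {t} r → c ∉ t → IsSubword (c ∷ t ++ [ c ]) (copies B r) → t ≡ B
    separated-block {t} r c∉t (u , v , eq) =
      copies-block r u c∉t (trans eq (cong (λ z → u ++ c ∷ z) (++-assoc t [ c ] v)))

-- symbol m i is the symbol i of the alphabet Fin (suc m); it is clamped at m, but only i ≤ m is used.
symbol : (m : ℕ) → ℕ → Fin (suc m)
symbol m       zero    = Fin.zero
symbol zero    (suc i) = Fin.zero
symbol (suc m) (suc i) = Fin.suc (symbol m i)

toℕ-symbol : ∀ {m i} → i ≤ m → toℕ (symbol m i) ≡ i
toℕ-symbol {m}     {zero}  _         = refl
toℕ-symbol {suc m} {suc i} (s≤s i≤m) = cong suc (toℕ-symbol i≤m)

module _ (m : ℕ) where

  extremal : ℕ → Word (suc m)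
  extremal zero    = [ symbol m 0 ]
  extremal (suc j) = copies (symbol m (suc j)) (extremal j) (suc j)

  toℕ≤-extremal : ∀ {j x} → j ≤ m → x ∈ extremal j → toℕ x ≤ j
  toℕ≤-extremal {zero}  _   (here refl) = z≤n
  toℕ≤-extremal {suc j} j<m x∈ with ∈-copies⁻ (symbol m (suc j)) (extremal j) (suc j) x∈
  ... | inj₁ x∈V  = m≤n⇒m≤1+n (toℕ≤-extremal (<⇒≤ j<m) x∈V)
  ... | inj₂ refl = ≤-reflexive (toℕ-symbol j<m)

  fresh-symbol : ∀ {j} → suc j ≤ m → symbol m (suc j) ∉ extremal j
  fresh-symbol {j} j<m c∈ = 1+n≰n (subst (_≤ j) (toℕ-symbol j<m) (toℕ≤-extremal (<⇒≤ j<m) c∈))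

  extremal-≢[] : ∀ j → extremal j ≢ []
  extremal-≢[] zero    ()
  extremal-≢[] (suc j) eq = case ++-conicalʳ (extremal j) _ eq of λ ()

  extremal-linked : ∀ {j} → j ≤ m → NoConsecutiveEqual (extremal j)
  extremal-linked {zero}  _   = [-]
  extremal-linked {suc j} j<m =
    copies-linked _ (extremal-≢[] j) (fresh-symbol j<m) (extremal-linked (<⇒≤ j<m)) (suc j)

  length-extremal : ∀ j → suc (length (extremal j)) ≡ 2 * suc j !
  length-extremal zero    = refl
  length-extremal (suc j) = begin
    suc (length (extremal (suc j)))           ≡⟨ length-copies _ (extremal j) (suc j) ⟩
    suc (suc j) * suc (length (extremal j))   ≡⟨ cong (suc (suc j) *_) (length-extremal j) ⟩
    suc (suc j) * (2 * suc j !)               ≡⟨ suc-*-2*n! (suc j) ⟩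
    2 * suc (suc j) !                         ∎
    where open ≡-Reasoning

  j<distinctCount-extremal : ∀ {j} → j ≤ m → j < distinctCount (extremal j)
  j<distinctCount-extremal {zero}  _   = distinctCount-∈ {s = extremal 0} (here refl)
  j<distinctCount-extremal {suc j} j<m = ≤-trans (s≤s (j<distinctCount-extremal (<⇒≤ j<m)))
    (distinctCount-strict ∈-++⁺ˡ (∈-++⁺ʳ (extremal j) (here refl)) (fresh-symbol j<m))

  extremal-HasRareSymbol : ∀ {j s} → j ≤ m → IsSubword s (extremal j) → 2 ≤ distinctCount s →
                           HasRareSymbol s
  extremal-HasRareSymbol {zero} {[]} _ _ 2≤dc =
    contradiction (subst (2 ≤_) (distinctCount-[] {suc m}) 2≤dc) λ ()
  extremal-HasRareSymbol {zero} {y ∷ s} _ s⊑V 2≤dc =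
    y , here refl , ≤-trans (s≤s (≤-trans (occ-mono y s⊑V) (length-filter (y ≟_) (extremal 0)))) 2≤dc
  extremal-HasRareSymbol {suc j} {s} j<m s⊑V 2≤dc with any? (symbol m (suc j) ≟_) s
  ... | no c∉s = extremal-HasRareSymbol (<⇒≤ j<m) (∉-IsSubword-copies _ (extremal j) (suc j) c∉s s⊑V) 2≤dc
  ... | yes c∈s with ∈-split c∈s
  ...   | s₁ , s₂ , refl , c∉s₁ with any? (symbol m (suc j) ≟_) s₂
  ...     | no c∉s₂ = _ , c∈s , subst (λ k → suc k ≤ distinctCount s) (sym (occ-once s₁ s₂ c∉s₁ c∉s₂)) 2≤dc
  ...     | yes c∈s₂ with ∈-split c∈s₂
  ...       | t , s₃ , refl , c∉t = _ , c∈s , rare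
    where
    c = symbol m (suc j)
    V = extremal j
    c∉V = fresh-symbol j<m
    t≡V : t ≡ V
    t≡V = separated-block c c∉V (suc j) c∉t
      (IsSubword-trans (s₁ , s₃ , cong (λ z → s₁ ++ c ∷ z) (sym (++-assoc t [ c ] s₃))) s⊑V)
    V⊆s : V ⊆ s₁ ++ c ∷ t ++ c ∷ s₃
    V⊆s b∈V = ∈-++⁺ʳ s₁ (there (∈-++⁺ˡ (subst (_ ∈_) (sym t≡V) b∈V)))
    rare : occ c (s₁ ++ c ∷ t ++ c ∷ s₃) < distinctCount (s₁ ++ c ∷ t ++ c ∷ s₃)
    rare = begin-strict
      occ c (s₁ ++ c ∷ t ++ c ∷ s₃)  ≤⟨ occ-mono c s⊑V ⟩
      occ c (extremal (suc j))        ≡⟨ occ-copies c c∉V (suc j) ⟩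
      suc j                           <⟨ s≤s (j<distinctCount-extremal (<⇒≤ j<m)) ⟩
      suc (distinctCount V)           ≤⟨ distinctCount-strict V⊆s c∈s c∉V ⟩
      distinctCount (s₁ ++ c ∷ t ++ c ∷ s₃) ∎
      where open ≤-Reasoning

  extremal-¬HasGoodSubword : ¬ HasGoodSubword (extremal m)
  extremal-¬HasGoodSubword (k , 1<k , _ , s , s⊑V , good@(dc≡k , _)) =
    HasRareSymbol⇒¬KGood (extremal-HasRareSymbol ≤-refl s⊑V (subst (2 ≤_) (sym dc≡k) 1<k)) good

lemma9 : (n : ℕ) → 1 < n →
    ((w : Word n) → NoConsecutiveEqual w → 2 * n ! ∸ 1 < length w → HasGoodSubword w)
    × (Σ[ w ∈ Word n ] (length w ≡ 2 * n ! ∸ 1 × NoConsecutiveEqual w × ¬ HasGoodSubword w))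
lemma9 zero    ()
lemma9 (suc m) _ =
  long⇒HasGoodSubword ,
  extremal m m , cong (_∸ 1) (length-extremal m m) , extremal-linked m ≤-refl , extremal-¬HasGoodSubword m
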